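{- For every permutation $\pi$ of rank $n$, \[\mathbf{1}\cdot\pi=\mathbf{1}\cdot\mathbf{1}^{\mathrm{c}}+\operatorname{ninvsum}(\pi).\]
   Context: For a permutation $\pi$ of rank $n$ (a bijection of $\{1,\dots,n\}$), $\mathbf{1}\cdot\pi=\sum_{i=1}^n i\,\pi(i)$, where $\mathbf{1}=12\cdots n$ is the identity permutation of rank $n$. The complement of $\pi$ is $\pi^{\mathrm{c}}=(n+1-\pi_1)(n+1-\pi_2)\cdots(n+1-\pi_n)$, so $\mathbf{1}^{\mathrm{c}}=n(n-1)\cdots 1$. A non-inversion of $\pi$ is a pair $(a,b)$ with $1\le a<b\le n$ and $\pi(a)<\pi(b)$; $\mathrm{NINV}(\pi)$ is the set of non-inversions, and $\operatorname{ninvsum}(\pi)=\sum_{(a,b)\in\mathrm{NINV}(\pi)}(b-a)$. -}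

module Defs where

open import Data.Nat using (ℕ; suc; _+_; _*_; _∸_)
open import Data.Fin using (Fin; toℕ; _<?_)
open import Data.Fin.Permutation using (Permutation′; _⟨$⟩ʳ_)
open import Data.List using (List; map; allFin; concatMap)
open import Data.Nat.ListAction using (sum)
open import Relation.Nullary.Decidable using (does)
open import Data.Bool using (if_then_else_; _∧_)

-- Convention: Fin n = {0,…,n-1} encodes {1,…,n} via i ↦ toℕ i + 1.
-- The value of π at position i (as a number in 1..n).
val : ∀ {n} → Permutation′ n → Fin n → ℕ
val π i = suc (toℕ (π ⟨$⟩ʳ i))

pos : ∀ {n} → Fin n → ℕ
pos i = suc (toℕ i)

oneDot : ∀ {n} → Permutation′ n → ℕ
oneDot {n} π = sum (map (λ i → pos i * val π i) (allFin n))

oneDotOneᶜ : ℕ → ℕ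
oneDotOneᶜ n = sum (map (λ i → pos i * (suc n ∸ pos i)) (allFin n))

ninvsum : ∀ {n} → Permutation′ n → ℕ
ninvsum {n} π =
  sum (concatMap (λ a → map (λ b →
         if does (a <? b) ∧ does ((π ⟨$⟩ʳ a) <? (π ⟨$⟩ʳ b))
         then pos b ∸ pos a else 0) (allFin n)) (allFin n))

-- Write π(i) = 1 + #{j | π(j) < π(i)}. Then 𝟏·π = Σ i + Σ_{i,j} i·[π(j) < π(i)],
-- and grouping the double sum by unordered pairs {i < j}, each pair contributes
-- i·[π(j) < π(i)] + j·[π(i) < π(j)] = i + (j − i)·[π(i) < π(j)], since exactly one of the
-- two comparisons holds. The terms i add up, with Σ i, to Σ_i i·(1 + #{j > i}) = 𝟏·𝟏ᶜ,
-- and the terms (j − i)·[π(i) < π(j)] add up to ninvsum π.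
module Submission where

open import Defs
open import Data.Nat using (ℕ; zero; suc; _+_; _*_; _∸_; _≤_)
open import Data.Nat.Properties
  using ( +-*-semiring; +-assoc; +-identityʳ; *-comm; *-identityˡ; *-identityʳ; *-zeroʳ; *-suc
        ; +-∸-assoc; m+[n∸m]≡n; m≤n⇒m≤1+n)
open import Data.Nat.Solver using (module +-*-Solver)
open import Data.Fin as Fin using (Fin; toℕ; _<?_)
open import Data.Fin.Properties using (<-cmp; <-irrefl; toℕ<n)
open import Data.Fin.Permutation using (Permutation′; _⟨$⟩ʳ_)
open import Data.List using (List; []; _∷_; map; tabulate; allFin; concatMap)
open import Data.List.Properties using (map-tabulate)
import Data.Nat.ListAction as List
open import Data.Nat.ListAction.Properties using (sum-++)
open import Data.Bool using (if_then_else_; _∧_)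
open import Data.Empty using (⊥-elim)
open import Function using (_∘_; Injection)
open import Function.Properties.Inverse using (Inverse⇒Injection)
open import Relation.Binary.Definitions using (tri<; tri≈; tri>)
open import Relation.Binary.PropositionalEquality
  using (_≡_; _≢_; refl; sym; trans; cong; cong₂; module ≡-Reasoning)
open import Relation.Nullary.Decidable using (does; yes; no; dec-true; dec-false)

open import Algebra.Properties.Semiring.Sum +-*-semiring
  using (sum; sum-syntax; ∑-distrib-+; sum-cong-≗; sum-permute; sum-replicate-zero; *-distribˡ-sum; *-distribʳ-sum)

open +-*-Solver using (solve; _:=_; _:+_)

sum-tabulate : ∀ {n} (f : Fin n → ℕ) → List.sum (tabulate f) ≡ sum f
sum-tabulate {zero}  f = refl
sum-tabulate {suc n} f = cong (f Fin.zero +_) (sum-tabulate (f ∘ Fin.suc))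

sum-map-allFin : ∀ {n} (f : Fin n → ℕ) → List.sum (map f (allFin n)) ≡ sum f
sum-map-allFin f = trans (cong List.sum (map-tabulate (λ i → i) f)) (sum-tabulate f)

sum-concatMap : ∀ {A : Set} (f : A → List ℕ) (xs : List A) →
                List.sum (concatMap f xs) ≡ List.sum (map (List.sum ∘ f) xs)
sum-concatMap f []       = refl
sum-concatMap f (x ∷ xs) = trans (sum-++ (f x) _) (cong (List.sum (f x) +_) (sum-concatMap f xs))

𝟙[_<_] : ∀ {n} → Fin n → Fin n → ℕ
𝟙[ i < j ] = if does (i <? j) then 1 else 0

𝟙[<]-irrefl : ∀ {n} (i : Fin n) → 𝟙[ i < i ] ≡ 0
𝟙[<]-irrefl i = cong (if_then 1 else 0) (dec-false (i <? i) (<-irrefl refl))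

∑-ones : ∀ n → ∑[ k < n ] 1 ≡ n
∑-ones zero    = refl
∑-ones (suc n) = cong suc (∑-ones n)

count-below : ∀ {n} (x : Fin n) → ∑[ k < n ] 𝟙[ k < x ] ≡ toℕ x
count-below {suc n} Fin.zero    = sum-replicate-zero n
count-below {suc n} (Fin.suc x) = cong suc (count-below x)

count-above : ∀ {n} (x : Fin n) → ∑[ k < n ] 𝟙[ x < k ] ≡ n ∸ suc (toℕ x)
count-above {suc n} Fin.zero    = ∑-ones n
count-above {suc n} (Fin.suc x) = count-above x

count-below-permute : ∀ {n} (π : Permutation′ n) (x : Fin n) → ∑[ j < n ] 𝟙[ π ⟨$⟩ʳ j < x ] ≡ toℕ x
count-below-permute π x = trans (sym (sum-permute (λ k → 𝟙[ k < x ]) π)) (count-below x)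

∑∑-split-diagonal : ∀ {n} (g : Fin n → Fin n → ℕ) →
  ∑[ i < n ] ∑[ j < n ] g i j ≡ ∑[ i < n ] ∑[ j < n ] (𝟙[ i < j ] * (g i j + g j i)) + ∑[ i < n ] g i i
∑∑-split-diagonal {zero}  g = refl
∑∑-split-diagonal {suc n} g = begin
  g₀₀ + row₀ + ∑[ i < n ] (g (Fin.suc i) Fin.zero + ∑[ j < n ] g (Fin.suc i) (Fin.suc j))
    ≡⟨ cong (g₀₀ + row₀ +_) (∑-distrib-+ (λ i → g (Fin.suc i) Fin.zero) (λ i → ∑[ j < n ] g (Fin.suc i) (Fin.suc j))) ⟩
  g₀₀ + row₀ + (col₀ + ∑[ i < n ] ∑[ j < n ] g (Fin.suc i) (Fin.suc j))
    ≡⟨ cong (λ s → g₀₀ + row₀ + (col₀ + s)) (∑∑-split-diagonal (λ i j → g (Fin.suc i) (Fin.suc j))) ⟩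
  g₀₀ + row₀ + (col₀ + (offDiag + diag))
    ≡⟨ solve 5 (λ a r c o d → a :+ r :+ (c :+ (o :+ d)) := r :+ c :+ o :+ (a :+ d)) refl g₀₀ row₀ col₀ offDiag diag ⟩
  row₀ + col₀ + offDiag + (g₀₀ + diag)
    ≡⟨ cong (λ s → s + offDiag + (g₀₀ + diag)) (sym (∑-distrib-+ (λ j → g Fin.zero (Fin.suc j)) (λ j → g (Fin.suc j) Fin.zero))) ⟩
  ∑[ j < n ] (g Fin.zero (Fin.suc j) + g (Fin.suc j) Fin.zero) + offDiag + (g₀₀ + diag)
    ≡⟨ cong (λ s → s + offDiag + (g₀₀ + diag)) (sum-cong-≗ (λ j → sym (*-identityˡ (g Fin.zero (Fin.suc j) + g (Fin.suc j) Fin.zero)))) ⟩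
  ∑[ j < n ] (1 * (g Fin.zero (Fin.suc j) + g (Fin.suc j) Fin.zero)) + offDiag + (g₀₀ + diag)
    ∎
  where
  open ≡-Reasoning
  g₀₀ row₀ col₀ offDiag diag : ℕ
  g₀₀     = g Fin.zero Fin.zero
  row₀    = ∑[ j < n ] g Fin.zero (Fin.suc j)
  col₀    = ∑[ i < n ] g (Fin.suc i) Fin.zero
  offDiag = ∑[ i < n ] ∑[ j < n ] (𝟙[ i < j ] * (g (Fin.suc i) (Fin.suc j) + g (Fin.suc j) (Fin.suc i)))
  diag    = ∑[ i < n ] g (Fin.suc i) (Fin.suc i)

weigh-comparison : ∀ {n} {x y : ℕ} {a b : Fin n} → x ≤ y → a ≢ b →
  x * 𝟙[ b < a ] + y * 𝟙[ a < b ] ≡ x + (if does (a <? b) then y ∸ x else 0)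
weigh-comparison {x = x} {y} {a} {b} x≤y a≢b with <-cmp a b
... | tri< a<b _ b≮a rewrite dec-true (a <? b) a<b | dec-false (b <? a) b≮a =
  trans (cong₂ _+_ (*-zeroʳ x) (*-identityʳ y)) (sym (m+[n∸m]≡n x≤y))
... | tri≈ _ a≡b _ = ⊥-elim (a≢b a≡b)
... | tri> a≮b _ b<a rewrite dec-false (a <? b) a≮b | dec-true (b <? a) b<a =
  cong₂ _+_ (*-identityʳ x) (*-zeroʳ y)

oneDotOneᶜ≡∑pos+∑∑above : ∀ n →
  oneDotOneᶜ n ≡ ∑[ i < n ] pos i + ∑[ i < n ] ∑[ j < n ] (𝟙[ i < j ] * pos i)
oneDotOneᶜ≡∑pos+∑∑above n = begin
  oneDotOneᶜ n
    ≡⟨ sum-map-allFin {n} (λ i → pos i * (suc n ∸ pos i)) ⟩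
  ∑[ i < n ] (pos i * (suc n ∸ pos i))
    ≡⟨ sum-cong-≗ (λ i → sym (row i)) ⟩
  ∑[ i < n ] (pos i + ∑[ j < n ] (𝟙[ i < j ] * pos i))
    ≡⟨ ∑-distrib-+ (pos {n}) (λ i → ∑[ j < n ] (𝟙[ i < j ] * pos i)) ⟩
  ∑[ i < n ] pos i + ∑[ i < n ] ∑[ j < n ] (𝟙[ i < j ] * pos i)
    ∎
  where
  open ≡-Reasoning
  row : (i : Fin n) → pos i + ∑[ j < n ] (𝟙[ i < j ] * pos i) ≡ pos i * (suc n ∸ pos i)
  row i = begin
    pos i + ∑[ j < n ] (𝟙[ i < j ] * pos i) ≡⟨ cong (pos i +_) (sym (*-distribʳ-sum (pos i) (λ j → 𝟙[ i < j ]))) ⟩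
    pos i + ∑[ j < n ] 𝟙[ i < j ] * pos i   ≡⟨ *-comm (suc (∑[ j < n ] 𝟙[ i < j ])) (pos i) ⟩
    pos i * suc (∑[ j < n ] 𝟙[ i < j ])     ≡⟨ cong (λ c → pos i * suc c) (count-above i) ⟩
    pos i * suc (n ∸ pos i)                 ≡⟨ cong (pos i *_) (sym (+-∸-assoc 1 (toℕ<n i))) ⟩
    pos i * (suc n ∸ pos i)                 ∎

module _ {n : ℕ} (π : Permutation′ n) where

  σ : Fin n → Fin n
  σ i = π ⟨$⟩ʳ i

  σ-injective : ∀ {i j} → σ i ≡ σ j → i ≡ j
  σ-injective = Injection.injective (Inverse⇒Injection π)

  nonInversionGap : Fin n → Fin n → ℕ
  nonInversionGap a b = if does (a <? b) ∧ does (σ a <? σ b) then pos b ∸ pos a else 0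

  ninvsum≡∑∑gap : ninvsum π ≡ ∑[ a < n ] ∑[ b < n ] nonInversionGap a b
  ninvsum≡∑∑gap = begin
    ninvsum π                                  ≡⟨ sum-concatMap row (allFin n) ⟩
    List.sum (map (List.sum ∘ row) (allFin n)) ≡⟨ sum-map-allFin (List.sum ∘ row) ⟩
    ∑[ a < n ] List.sum (row a)                ≡⟨ sum-cong-≗ (λ a → sum-map-allFin (nonInversionGap a)) ⟩
    ∑[ a < n ] ∑[ b < n ] nonInversionGap a b  ∎
    where
    open ≡-Reasoning
    row : Fin n → List ℕ
    row a = map (nonInversionGap a) (allFin n)

  oneDot≡∑pos+∑∑below : oneDot π ≡ ∑[ i < n ] pos i + ∑[ i < n ] ∑[ j < n ] (pos i * 𝟙[ σ j < σ i ])
  oneDot≡∑pos+∑∑below = begin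
    oneDot π
      ≡⟨ sum-map-allFin (λ i → pos i * val π i) ⟩
    ∑[ i < n ] (pos i * suc (toℕ (σ i)))
      ≡⟨ sum-cong-≗ (λ i → cong (λ r → pos i * suc r) (sym (count-below-permute π (σ i)))) ⟩
    ∑[ i < n ] (pos i * suc (∑[ j < n ] 𝟙[ σ j < σ i ]))
      ≡⟨ sum-cong-≗ {n} (λ i → *-suc (pos i) (∑[ j < n ] 𝟙[ σ j < σ i ])) ⟩
    ∑[ i < n ] (pos i + pos i * ∑[ j < n ] 𝟙[ σ j < σ i ])
      ≡⟨ ∑-distrib-+ (pos {n}) (λ i → pos i * ∑[ j < n ] 𝟙[ σ j < σ i ]) ⟩
    ∑[ i < n ] pos i + ∑[ i < n ] (pos i * ∑[ j < n ] 𝟙[ σ j < σ i ])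
      ≡⟨ cong (∑[ i < n ] pos i +_) (sum-cong-≗ (λ i → *-distribˡ-sum (pos i) (λ j → 𝟙[ σ j < σ i ]))) ⟩
    ∑[ i < n ] pos i + ∑[ i < n ] ∑[ j < n ] (pos i * 𝟙[ σ j < σ i ])
      ∎
    where open ≡-Reasoning

  weigh-pair : (i j : Fin n) →
    𝟙[ i < j ] * (pos i * 𝟙[ σ j < σ i ] + pos j * 𝟙[ σ i < σ j ]) ≡ 𝟙[ i < j ] * pos i + nonInversionGap i j
  weigh-pair i j with i <? j
  ... | no i≮j rewrite dec-false (i <? j) i≮j = refl
  ... | yes i<j rewrite dec-true (i <? j) i<j = begin
    1 * (pos i * 𝟙[ σ j < σ i ] + pos j * 𝟙[ σ i < σ j ]) ≡⟨ *-identityˡ _ ⟩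
    pos i * 𝟙[ σ j < σ i ] + pos j * 𝟙[ σ i < σ j ]       ≡⟨ weigh-comparison (m≤n⇒m≤1+n i<j) σi≢σj ⟩
    pos i + gap                                           ≡⟨ cong (_+ gap) (sym (*-identityˡ (pos i))) ⟩
    1 * pos i + gap                                       ∎
    where
    open ≡-Reasoning
    gap : ℕ
    gap = if does (σ i <? σ j) then pos j ∸ pos i else 0
    σi≢σj : σ i ≢ σ j
    σi≢σj σi≡σj = <-irrefl (σ-injective σi≡σj) i<j

  ∑∑below≡∑∑above+∑∑gap :
    ∑[ i < n ] ∑[ j < n ] (pos i * 𝟙[ σ j < σ i ])
      ≡ ∑[ i < n ] ∑[ j < n ] (𝟙[ i < j ] * pos i) + ∑[ i < n ] ∑[ j < n ] nonInversionGap i j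
  ∑∑below≡∑∑above+∑∑gap = begin
    ∑[ i < n ] ∑[ j < n ] below i j
      ≡⟨ ∑∑-split-diagonal below ⟩
    ∑[ i < n ] ∑[ j < n ] (𝟙[ i < j ] * (below i j + below j i)) + ∑[ i < n ] below i i
      ≡⟨ cong₂ _+_ (sum-cong-≗ (λ i → sum-cong-≗ (weigh-pair i))) diagonal≡0 ⟩
    ∑[ i < n ] ∑[ j < n ] (𝟙[ i < j ] * pos i + nonInversionGap i j) + 0
      ≡⟨ +-identityʳ _ ⟩
    ∑[ i < n ] ∑[ j < n ] (𝟙[ i < j ] * pos i + nonInversionGap i j)
      ≡⟨ sum-cong-≗ (λ i → ∑-distrib-+ (λ j → 𝟙[ i < j ] * pos i) (nonInversionGap i)) ⟩
    ∑[ i < n ] (∑[ j < n ] (𝟙[ i < j ] * pos i) + ∑[ j < n ] nonInversionGap i j)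
      ≡⟨ ∑-distrib-+ (λ i → ∑[ j < n ] (𝟙[ i < j ] * pos i)) (λ i → ∑[ j < n ] nonInversionGap i j) ⟩
    ∑[ i < n ] ∑[ j < n ] (𝟙[ i < j ] * pos i) + ∑[ i < n ] ∑[ j < n ] nonInversionGap i j
      ∎
    where
    open ≡-Reasoning
    below : Fin n → Fin n → ℕ
    below i j = pos i * 𝟙[ σ j < σ i ]
    diagonal≡0 : ∑[ i < n ] below i i ≡ 0
    diagonal≡0 = trans (sum-cong-≗ (λ i → trans (cong (pos i *_) (𝟙[<]-irrefl (σ i))) (*-zeroʳ (pos i))))
                       (sum-replicate-zero n)

theorem2p5 : (n : ℕ) (π : Permutation′ n) → oneDot π ≡ oneDotOneᶜ n + ninvsum π
theorem2p5 n π = begin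
  oneDot π                                  ≡⟨ oneDot≡∑pos+∑∑below π ⟩
  ∑[ i < n ] pos i + ∑∑below                  ≡⟨ cong (∑[ i < n ] pos i +_) (∑∑below≡∑∑above+∑∑gap π) ⟩
  ∑[ i < n ] pos i + (∑∑above + ∑∑gap)        ≡⟨ sym (+-assoc (∑[ i < n ] pos i) ∑∑above ∑∑gap) ⟩
  ∑[ i < n ] pos i + ∑∑above + ∑∑gap          ≡⟨ cong₂ _+_ (sym (oneDotOneᶜ≡∑pos+∑∑above n)) (sym (ninvsum≡∑∑gap π)) ⟩
  oneDotOneᶜ n + ninvsum π                  ∎
  where
  open ≡-Reasoning
  ∑∑below ∑∑above ∑∑gap : ℕ
  ∑∑below = ∑[ i < n ] ∑[ j < n ] (pos i * 𝟙[ σ π j < σ π i ])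
  ∑∑above = ∑[ i < n ] ∑[ j < n ] (𝟙[ i < j ] * pos i)
  ∑∑gap   = ∑[ i < n ] ∑[ j < n ] nonInversionGap π i j
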